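{- Let $(g(x),f(x))$ be a Riordan array, let $n\ge2$, and let $(g(x),f(x))_n$ denote its $n\times n$ leading principal truncation. Let $S_n=(g(x),f(x))_n\cdot T_n$, where $T_n$ is the $n\times n$ upper-triangular matrix with all entries on and above the diagonal equal to $1$, and let $H=S_n^{ -1}$ with rows and columns indexed $1,\dots,n$. Let $P_{n-1}$ be the $(n-1)\times(n-1)$ submatrix of $H$ formed by rows $1,\dots,n-1$ and columns $2,\dots,n$. Then $$P_{n-1}^{ -1}=\left(\frac{ -g(x)f(x)/x}{1-f(x)},f(x)\right)_{n-1},$$ the $(n-1)\times(n-1)$ leading truncation of the Riordan array $\left(\frac{ -g(x)f(x)/x}{1-f(x)},f(x)\right)$.
   Context: Throughout, $g(x)=\sum_{i\ge0}g_ix^i$ and $f(x)=\sum_{i\ge1}f_ix^i$ are formal power series with integer coefficients, $g_0=1$, $f_1=1$. For a power series $u$ with $u(0)\ne0$ and $v$ with $v(0)=0$, $v'(0)\ne0$, the Riordan array $(u(x),v(x))$ is the infinite lower-triangular matrix with $(i,k)$-entry $[x^i]u(x)v(x)^k$ ($i,k\ge0$), and $(u,v)_m$ denotes its $m\times m$ leading principal submatrix. -}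

module Defs where

open import Data.Nat using (ℕ; zero; suc; _∸_; _≤?_)
open import Data.Integer using (ℤ; +_; _+_; _*_; -_; 0ℤ; 1ℤ)
open import Data.Fin using (Fin; zero; suc; toℕ; inject₁)
open import Relation.Nullary using (yes; no)
open import Relation.Nullary.Decidable using (⌊_⌋)
open import Data.Bool using (if_then_else_)

-- Formal power series over ℤ, as coefficient sequences: s i = [x^i] s.
Series : Set
Series = ℕ → ℤ

sumFin : (n : ℕ) → (Fin n → ℤ) → ℤ
sumFin zero    h = 0ℤ
sumFin (suc n) h = h zero + sumFin n (λ i → h (suc i))

oneS : Series
oneS zero    = 1ℤ
oneS (suc _) = 0ℤ

_⊕_ : Series → Series → Series
(a ⊕ b) i = a i + b i

negS : Series → Series
negS a i = - a i

_⊛_ : Series → Series → Series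
(a ⊛ b) i = sumFin (suc i) (λ j → a (toℕ j) * b (i ∸ toℕ j))

powS : Series → ℕ → Series
powS v zero    = oneS
powS v (suc k) = v ⊛ powS v k

-- f(x)/x (meaningful when f(0) = 0)
divX : Series → Series
divX f i = f (suc i)

-- Square matrices over ℤ of size m, indices Fin m (0-based).
Mat : ℕ → Set
Mat m = Fin m → Fin m → ℤ

_·_ : {m : ℕ} → Mat m → Mat m → Mat m
_·_ {m} A B i j = sumFin m (λ k → A i k * B k j)

idMat : {m : ℕ} → Mat m
idMat i j = if ⌊ toℕ i Data.Nat.≟ toℕ j ⌋ then 1ℤ else 0ℤ

upperOnes : (m : ℕ) → Mat m
upperOnes m i j = if ⌊ toℕ i ≤? toℕ j ⌋ then 1ℤ else 0ℤ

riordanTrunc : Series → Series → (m : ℕ) → Mat m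
riordanTrunc u v m i k = (u ⊛ powS v (toℕ k)) (toℕ i)

IsInverseOf : {m : ℕ} → Mat m → Mat m → Set
IsInverseOf A B = (∀ i j → (A · B) i j ≡ idMat i j) × (∀ i j → (B · A) i j ≡ idMat i j)
  where open import Relation.Binary.PropositionalEquality using (_≡_)
        open import Data.Product using (_×_)

-- Submatrix of an (m+1)×(m+1) matrix H: rows 1..m, columns 2..m+1
-- (1-based), i.e. 0-based rows 0..m-1 and columns 1..m.
subP : {m : ℕ} → Mat (suc m) → Mat m
subP H i j = H (inject₁ i) (suc j)

-- Column k of S is the sum of columns 0..k of (g,f)ₙ, so row 0 of S is all
-- ones. From u(1 - f) = -g f/x one gets u fᵏ⁺¹ = u fᵏ + (g fᵏ⁺¹)/x, and telescoping in k, anchored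
-- at k = n-1 where u fⁿ⁻¹ has no terms of degree < n-1, gives [xⁱ] u fᵏ = S(i+1,k) - S(i+1,n-1).
-- Thus (u,f)ₙ₋₁ is obtained from S by deleting row 0, subtracting the last column from the others
-- and deleting it. For any invertible S whose row 0 is all ones, this matrix inverts the block P of
-- S⁻¹: row 0 of S annihilates every column of S⁻¹ but the first, and the last column of S
-- annihilates every row of S⁻¹ but the last.

module Submission where

open import Defs
open import Data.Nat using (ℕ; zero; suc; _≤_; _<_; _≟_; _≤?_; z≤n; s≤s; s≤s⁻¹)
import Data.Nat.Properties as ℕ
open import Data.Integer using (ℤ; +_; _+_; _-_; _*_; -_; 0ℤ; 1ℤ)
import Data.Integer.Properties as ℤ
open import Data.Integer.Tactic.RingSolver using (solve-∀)
open import Data.Fin using (Fin; zero; suc; toℕ; inject₁; fromℕ)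
import Data.Fin.Properties as Fin
open import Data.Product using (_,_)
open import Function using (_∘_)
open import Function.Bundles using (_⇔_; mk⇔)
open import Relation.Binary.PropositionalEquality
open import Data.Bool using (false; if_then_else_)
open import Relation.Nullary using (Dec; ¬_)
open import Relation.Nullary.Decidable using (⌊_⌋; isYes≗does; dec-false; does-⇔)
open import Algebra.Properties.Semiring.Sum ℤ.+-*-semiring
  using (sum; sum-syntax; sum⁺-syntax; sum-cong-≗; sum-replicate-zero; sum-init-last; *-distribˡ-sum)

open ≡-Reasoning

-- Formal power series

scaleS : ℤ → Series → Series
scaleS s a i = s * a i

⊛-head : (a b : Series) → (a ⊛ b) 0 ≡ a 0 * b 0
⊛-head a b = ℤ.+-identityʳ (a 0 * b 0)

⊛-congˡ : ∀ {a a'} (b : Series) → a ≗ a' → a ⊛ b ≗ a' ⊛ b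
⊛-congˡ b a≗a' zero = cong (λ x → x * b 0 + 0ℤ) (a≗a' 0)
⊛-congˡ b a≗a' (suc i) = cong₂ _+_ (cong (_* b (suc i)) (a≗a' 0)) (⊛-congˡ b (a≗a' ∘ suc) i)

⊛-congʳ : ∀ (a : Series) {b b'} → b ≗ b' → a ⊛ b ≗ a ⊛ b'
⊛-congʳ a b≗b' zero = cong (λ x → a 0 * x + 0ℤ) (b≗b' 0)
⊛-congʳ a b≗b' (suc i) = cong₂ _+_ (cong (a 0 *_) (b≗b' (suc i))) (⊛-congʳ (divX a) b≗b' i)

⊛-identityʳ : (a : Series) → a ⊛ oneS ≗ a
⊛-identityʳ a zero = trans (⊛-head a oneS) (ℤ.*-identityʳ (a 0))
⊛-identityʳ a (suc i) rewrite ⊛-identityʳ (divX a) i =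
  trans (cong (_+ a (suc i)) (ℤ.*-zeroʳ (a 0))) (ℤ.+-identityˡ (a (suc i)))

⊛-distribˡ-⊕ : (a b c : Series) → a ⊛ (b ⊕ c) ≗ (a ⊛ b) ⊕ (a ⊛ c)
⊛-distribˡ-⊕ a b c zero rewrite ⊛-head a (b ⊕ c) | ⊛-head a b | ⊛-head a c =
  ℤ.*-distribˡ-+ (a 0) (b 0) (c 0)
⊛-distribˡ-⊕ a b c (suc i) rewrite ⊛-distribˡ-⊕ (divX a) b c i =
  lemma (a 0) (b (suc i)) (c (suc i)) _ _
  where
  lemma : ∀ x y z p q → x * (y + z) + (p + q) ≡ (x * y + p) + (x * z + q)
  lemma = solve-∀

⊛-distribʳ-⊕ : (a b c : Series) → (a ⊕ b) ⊛ c ≗ (a ⊛ c) ⊕ (b ⊛ c)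
⊛-distribʳ-⊕ a b c zero rewrite ⊛-head (a ⊕ b) c | ⊛-head a c | ⊛-head b c =
  ℤ.*-distribʳ-+ (c 0) (a 0) (b 0)
⊛-distribʳ-⊕ a b c (suc i) rewrite ⊛-distribʳ-⊕ (divX a) (divX b) c i =
  lemma (a 0) (b 0) (c (suc i)) _ _
  where
  lemma : ∀ x y z p q → (x + y) * z + (p + q) ≡ (x * z + p) + (y * z + q)
  lemma = solve-∀

⊛-negʳ : (a b : Series) → a ⊛ negS b ≗ negS (a ⊛ b)
⊛-negʳ a b zero rewrite ⊛-head a (negS b) | ⊛-head a b = sym (ℤ.neg-distribʳ-* (a 0) (b 0))
⊛-negʳ a b (suc i) rewrite ⊛-negʳ (divX a) b i = lemma (a 0) (b (suc i)) _
  where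
  lemma : ∀ x z p → x * (- z) + (- p) ≡ - (x * z + p)
  lemma = solve-∀

⊛-scaleˡ : (s : ℤ) (a c : Series) → scaleS s a ⊛ c ≗ scaleS s (a ⊛ c)
⊛-scaleˡ s a c zero rewrite ⊛-head (scaleS s a) c | ⊛-head a c = ℤ.*-assoc s (a 0) (c 0)
⊛-scaleˡ s a c (suc i) rewrite ⊛-scaleˡ s (divX a) c i = lemma s (a 0) (c (suc i)) _
  where
  lemma : ∀ s x z p → s * x * z + s * p ≡ s * (x * z + p)
  lemma = solve-∀

-- The tail of a ⊛ b is  a 0 · (tail b) + (tail a) ⊛ b  on the nose.
⊛-assoc : (a b c : Series) → (a ⊛ b) ⊛ c ≗ a ⊛ (b ⊛ c)
⊛-assoc a b c zero
  rewrite ⊛-head (a ⊛ b) c | ⊛-head a (b ⊛ c) | ⊛-head a b | ⊛-head b c = ℤ.*-assoc (a 0) (b 0) (c 0)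
⊛-assoc a b c (suc i) = begin
  (a ⊛ b) 0 * c (suc i) + (divX (a ⊛ b) ⊛ c) i
    ≡⟨ cong₂ _+_ (cong (_* c (suc i)) (⊛-head a b)) (⊛-distribʳ-⊕ (scaleS (a 0) (divX b)) (divX a ⊛ b) c i) ⟩
  a 0 * b 0 * c (suc i) + ((scaleS (a 0) (divX b) ⊛ c) i + ((divX a ⊛ b) ⊛ c) i)
    ≡⟨ cong₂ (λ x y → a 0 * b 0 * c (suc i) + (x + y)) (⊛-scaleˡ (a 0) (divX b) c i) (⊛-assoc (divX a) b c i) ⟩
  a 0 * b 0 * c (suc i) + (a 0 * (divX b ⊛ c) i + (divX a ⊛ (b ⊛ c)) i)
    ≡⟨ lemma (a 0) (b 0) (c (suc i)) _ _ ⟩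
  a 0 * (b 0 * c (suc i) + (divX b ⊛ c) i) + (divX a ⊛ (b ⊛ c)) i
    ∎
  where
  lemma : ∀ x y z p q → x * y * z + (x * p + q) ≡ x * (y * z + p) + q
  lemma = solve-∀

divX-⊛ˡ : (a b : Series) → a 0 ≡ 0ℤ → divX (a ⊛ b) ≗ divX a ⊛ b
divX-⊛ˡ a b a₀≡0 i rewrite a₀≡0 = ℤ.+-identityˡ ((divX a ⊛ b) i)

divX-⊛ʳ : (a b : Series) → b 0 ≡ 0ℤ → divX (a ⊛ b) ≗ a ⊛ divX b
divX-⊛ʳ a b b₀≡0 zero rewrite ⊛-head (divX a) b | b₀≡0 | ⊛-head a (divX b) =
  trans (cong (λ x → a 0 * b 1 + x) (ℤ.*-zeroʳ (a 1))) (ℤ.+-identityʳ (a 0 * b 1))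
divX-⊛ʳ a b b₀≡0 (suc i) rewrite divX-⊛ʳ (divX a) b b₀≡0 i = refl

OrderAtLeast : ℕ → Series → Set
OrderAtLeast k a = ∀ j → j < k → a j ≡ 0ℤ

⊛-orderʳ : ∀ {k} (a b : Series) → OrderAtLeast k b → OrderAtLeast k (a ⊛ b)
⊛-orderʳ a b ord zero j<k rewrite ⊛-head a b | ord 0 j<k = ℤ.*-zeroʳ (a 0)
⊛-orderʳ a b ord (suc j) j<k
  rewrite ord (suc j) j<k | ⊛-orderʳ (divX a) b ord j (ℕ.<-trans (ℕ.n<1+n j) j<k) =
  trans (ℤ.+-identityʳ (a 0 * 0ℤ)) (ℤ.*-zeroʳ (a 0))

powS-order : (f : Series) → f 0 ≡ 0ℤ → ∀ k → OrderAtLeast k (powS f k)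
powS-order f f₀≡0 (suc k) zero _ rewrite ⊛-head f (powS f k) | f₀≡0 = refl
powS-order f f₀≡0 (suc k) (suc j) (s≤s j<k)
  rewrite f₀≡0 | ⊛-orderʳ (divX f) (powS f k) (powS-order f f₀≡0 k) j j<k = refl

-- Finite sums and telescoping

sumFin≡sum : ∀ n (h : Fin n → ℤ) → sumFin n h ≡ sum h
sumFin≡sum zero    h = refl
sumFin≡sum (suc n) h = cong (_+_ (h zero)) (sumFin≡sum n (h ∘ suc))

∑-zero : ∀ {n} {x : Fin n → ℤ} → (∀ k → x k ≡ 0ℤ) → ∑[ k < n ] x k ≡ 0ℤ
∑-zero {n} x≗0 = trans (sum-cong-≗ x≗0) (sum-replicate-zero n)

∑-head-zero : ∀ {n} (x : Fin (suc n) → ℤ) → x zero ≡ 0ℤ → ∑[ k ≤ n ] x k ≡ ∑[ k < n ] x (suc k)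
∑-head-zero {n} x x₀≡0 = trans (cong (_+ ∑[ k < n ] x (suc k)) x₀≡0) (ℤ.+-identityˡ _)

∑-last-zero : ∀ {n} (x : Fin (suc n) → ℤ) → x (fromℕ n) ≡ 0ℤ → ∑[ k ≤ n ] x k ≡ ∑[ k < n ] x (inject₁ k)
∑-last-zero {n} x xₙ≡0 =
  trans (sum-init-last x) (trans (cong (_+_ (∑[ k < n ] x (inject₁ k))) xₙ≡0) (ℤ.+-identityʳ _))

∑-distrib-- : ∀ {n} (x y : Fin n → ℤ) → ∑[ k < n ] (x k - y k) ≡ ∑[ k < n ] x k - ∑[ k < n ] y k
∑-distrib-- {zero}  x y = refl
∑-distrib-- {suc n} x y rewrite ∑-distrib-- (x ∘ suc) (y ∘ suc) = lemma (x zero) (y zero) _ _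
  where
  lemma : ∀ a b s t → (a - b) + (s - t) ≡ (a + s) - (b + t)
  lemma = solve-∀

∑≤-suc : ∀ (r : ℕ → ℤ) k → ∑[ p ≤ suc k ] r (toℕ p) ≡ ∑[ p ≤ k ] r (toℕ p) + r (suc k)
∑≤-suc r k = trans (sum-init-last {suc k} (r ∘ toℕ))
  (cong₂ _+_ (sum-cong-≗ {suc k} (cong r ∘ Fin.toℕ-inject₁)) (cong r (Fin.toℕ-fromℕ (suc k))))

telescope : (b r : ℕ → ℤ) → (∀ k → b (suc k) ≡ b k + r (suc k)) →
  ∀ k → b k - ∑[ p ≤ k ] r (toℕ p) ≡ b 0 - r 0
telescope b r step zero = cong (_-_ (b 0)) (ℤ.+-identityʳ (r 0))
telescope b r step (suc k) rewrite step k | ∑≤-suc r k =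
  trans (lemma (b k) (r (suc k)) _) (telescope b r step k)
  where
  lemma : ∀ x y s → (x + y) - (s + y) ≡ x - s
  lemma = solve-∀

telescope-anchored : (b r : ℕ → ℤ) → (∀ k → b (suc k) ≡ b k + r (suc k)) →
  ∀ m → b m ≡ 0ℤ → ∀ k → b k ≡ ∑[ p ≤ k ] r (toℕ p) - ∑[ p ≤ m ] r (toℕ p)
telescope-anchored b r step m bₘ≡0 k = begin
  b k                     ≡⟨ lemma₁ (b k) (P k) ⟩
  (b k - P k) + P k       ≡⟨ cong (_+ P k) (trans (telescope b r step k) (sym (telescope b r step m))) ⟩
  (b m - P m) + P k       ≡⟨ cong (λ x → (x - P m) + P k) bₘ≡0 ⟩
  (0ℤ - P m) + P k        ≡⟨ lemma₂ (P m) (P k) ⟩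
  P k - P m               ∎
  where
  P : ℕ → ℤ
  P l = ∑[ p ≤ l ] r (toℕ p)
  lemma₁ : ∀ x s → x ≡ (x - s) + s
  lemma₁ = solve-∀
  lemma₂ : ∀ s t → (0ℤ - s) + t ≡ t - s
  lemma₂ = solve-∀

-- Matrices

·-sum : ∀ {n} (A B : Mat n) i j → (A · B) i j ≡ ∑[ k < n ] (A i k * B k j)
·-sum {n} A B i j = sumFin≡sum n (λ k → A i k * B k j)

·-rowCombination : ∀ {n} (A B : Mat n) a b c j →
  ∑[ k < n ] ((A a k - c * A b k) * B k j) ≡ (A · B) a j - c * (A · B) b j
·-rowCombination {n} A B a b c j = begin
  ∑[ k < n ] ((A a k - c * A b k) * B k j)
    ≡⟨ sum-cong-≗ (λ k → lemma (A a k) (A b k) c (B k j)) ⟩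
  ∑[ k < n ] (A a k * B k j - c * (A b k * B k j))
    ≡⟨ ∑-distrib-- (λ k → A a k * B k j) (λ k → c * (A b k * B k j)) ⟩
  ∑[ k < n ] (A a k * B k j) - ∑[ k < n ] (c * (A b k * B k j))
    ≡⟨ cong₂ _-_ (·-sum A B a j) (*-distribˡ-sum c (λ k → A b k * B k j)) ⟨
  (A · B) a j - c * ∑[ k < n ] (A b k * B k j)
    ≡⟨ cong (λ x → (A · B) a j - c * x) (·-sum A B b j) ⟨
  (A · B) a j - c * (A · B) b j
    ∎
  where
  lemma : ∀ x y c z → (x - c * y) * z ≡ x * z - c * (y * z)
  lemma = solve-∀

·-columnDifference : ∀ {n} (A B : Mat n) i a b →
  ∑[ k < n ] (A i k * (B k a - B k b)) ≡ (A · B) i a - (A · B) i b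
·-columnDifference {n} A B i a b = begin
  ∑[ k < n ] (A i k * (B k a - B k b))
    ≡⟨ sum-cong-≗ (λ k → lemma (A i k) (B k a) (B k b)) ⟩
  ∑[ k < n ] (A i k * B k a - A i k * B k b)
    ≡⟨ ∑-distrib-- (λ k → A i k * B k a) (λ k → A i k * B k b) ⟩
  ∑[ k < n ] (A i k * B k a) - ∑[ k < n ] (A i k * B k b)
    ≡⟨ cong₂ _-_ (·-sum A B i a) (·-sum A B i b) ⟨
  (A · B) i a - (A · B) i b
    ∎
  where
  lemma : ∀ x y z → x * (y - z) ≡ x * y - x * z
  lemma = solve-∀

⌊⌋-⇔ : ∀ {A B : Set} → A ⇔ B → (a? : Dec A) (b? : Dec B) → ⌊ a? ⌋ ≡ ⌊ b? ⌋
⌊⌋-⇔ A⇔B a? b? = trans (isYes≗does a?) (trans (does-⇔ A⇔B a? b?) (sym (isYes≗does b?)))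

⌊⌋-false : ∀ {A : Set} (a? : Dec A) → ¬ A → ⌊ a? ⌋ ≡ false
⌊⌋-false a? ¬a = trans (isYes≗does a?) (dec-false a? ¬a)

idMat-reindex : ∀ {n n'} (a b : Fin n) (c d : Fin n') →
  (toℕ a ≡ toℕ b → toℕ c ≡ toℕ d) → (toℕ c ≡ toℕ d → toℕ a ≡ toℕ b) → idMat a b ≡ idMat c d
idMat-reindex a b c d to from =
  cong (λ t → if t then 1ℤ else 0ℤ) (⌊⌋-⇔ (mk⇔ to from) (toℕ a ≟ toℕ b) (toℕ c ≟ toℕ d))

idMat-≢ : ∀ {n} (a b : Fin n) → toℕ a ≢ toℕ b → idMat a b ≡ 0ℤ
idMat-≢ a b a≢b = cong (λ t → if t then 1ℤ else 0ℤ) (⌊⌋-false (toℕ a ≟ toℕ b) a≢b)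

subP-inverse : ∀ {m} (S H : Mat (suc m)) (B : Mat m) → IsInverseOf H S → (∀ k → S zero k ≡ 1ℤ) →
  (∀ i k → B i k ≡ S (suc i) (inject₁ k) - S (suc i) (fromℕ m)) → IsInverseOf B (subP H)
subP-inverse {m} S H B (H·S≡I , S·H≡I) row₀ B-def = B·P≡I , P·B≡I
  where
  B·P≡I : ∀ i j → (B · subP H) i j ≡ idMat i j
  B·P≡I i j = begin
    (B · subP H) i j
      ≡⟨ ·-sum B (subP H) i j ⟩
    ∑[ k < m ] (B i k * H (inject₁ k) (suc j))
      ≡⟨ sum-cong-≗ (λ k → cong (_* H (inject₁ k) (suc j)) (B≡row k)) ⟩
    ∑[ k < m ] (row (inject₁ k) * H (inject₁ k) (suc j))
      ≡⟨ ∑-last-zero (λ k → row k * H k (suc j)) last-zero ⟨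
    ∑[ k ≤ m ] (row k * H k (suc j))
      ≡⟨ ·-rowCombination S H (suc i) zero c (suc j) ⟩
    (S · H) (suc i) (suc j) - c * (S · H) zero (suc j)
      ≡⟨ cong₂ (λ x y → x - c * y) (S·H≡I (suc i) (suc j)) (S·H≡I zero (suc j)) ⟩
    idMat (suc i) (suc j) - c * idMat zero (suc j)
      ≡⟨ cong₂ (λ x y → x - c * y) (idMat-reindex (suc i) (suc j) i j ℕ.suc-injective (cong suc))
                                   (idMat-≢ zero (suc j) λ ()) ⟩
    idMat i j - c * 0ℤ
      ≡⟨ lemma (idMat i j) c ⟩
    idMat i j
      ∎
    where
    c : ℤ
    c = S (suc i) (fromℕ m)
    row : Fin (suc m) → ℤ
    row k = S (suc i) k - c * S zero k
    c*row₀ : ∀ k → c ≡ c * S zero k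
    c*row₀ k = trans (sym (ℤ.*-identityʳ c)) (cong (c *_) (sym (row₀ k)))
    B≡row : ∀ k → B i k ≡ row (inject₁ k)
    B≡row k = trans (B-def i k) (cong (λ x → S (suc i) (inject₁ k) - x) (c*row₀ (inject₁ k)))
    last-zero : row (fromℕ m) * H (fromℕ m) (suc j) ≡ 0ℤ
    last-zero = begin
      (c - c * S zero (fromℕ m)) * H (fromℕ m) (suc j)  ≡⟨ cong (λ x → (c - x) * H (fromℕ m) (suc j)) (c*row₀ (fromℕ m)) ⟨
      (c - c) * H (fromℕ m) (suc j)                     ≡⟨ cong (_* H (fromℕ m) (suc j)) (ℤ.+-inverseʳ c) ⟩
      0ℤ * H (fromℕ m) (suc j)                          ≡⟨ ℤ.*-zeroˡ (H (fromℕ m) (suc j)) ⟩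
      0ℤ                                                ∎
    lemma : ∀ x c → x - c * 0ℤ ≡ x
    lemma = solve-∀

  P·B≡I : ∀ i j → (subP H · B) i j ≡ idMat i j
  P·B≡I i j = begin
    (subP H · B) i j
      ≡⟨ ·-sum (subP H) B i j ⟩
    ∑[ k < m ] (H (inject₁ i) (suc k) * B k j)
      ≡⟨ sum-cong-≗ (λ k → cong (H (inject₁ i) (suc k) *_) (B-def k j)) ⟩
    ∑[ k < m ] (H (inject₁ i) (suc k) * column (suc k))
      ≡⟨ ∑-head-zero (λ k → H (inject₁ i) k * column k) head-zero ⟨
    ∑[ k ≤ m ] (H (inject₁ i) k * column k)
      ≡⟨ ·-columnDifference H S (inject₁ i) (inject₁ j) (fromℕ m) ⟩
    (H · S) (inject₁ i) (inject₁ j) - (H · S) (inject₁ i) (fromℕ m)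
      ≡⟨ cong₂ _-_ (H·S≡I (inject₁ i) (inject₁ j)) (H·S≡I (inject₁ i) (fromℕ m)) ⟩
    idMat (inject₁ i) (inject₁ j) - idMat (inject₁ i) (fromℕ m)
      ≡⟨ cong₂ _-_ (idMat-reindex (inject₁ i) (inject₁ j) i j inject₁-reflects inject₁-preserves)
                    (idMat-≢ (inject₁ i) (fromℕ m) inject₁≢fromℕ) ⟩
    idMat i j - 0ℤ
      ≡⟨ ℤ.+-identityʳ (idMat i j) ⟩
    idMat i j
      ∎
    where
    column : Fin (suc m) → ℤ
    column k = S k (inject₁ j) - S k (fromℕ m)
    head-zero : H (inject₁ i) zero * column zero ≡ 0ℤ
    head-zero = trans (cong (H (inject₁ i) zero *_)
      (cong₂ _-_ (row₀ (inject₁ j)) (row₀ (fromℕ m)))) (ℤ.*-zeroʳ (H (inject₁ i) zero))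
    inject₁-reflects : toℕ (inject₁ i) ≡ toℕ (inject₁ j) → toℕ i ≡ toℕ j
    inject₁-reflects e = trans (sym (Fin.toℕ-inject₁ i)) (trans e (Fin.toℕ-inject₁ j))
    inject₁-preserves : toℕ i ≡ toℕ j → toℕ (inject₁ i) ≡ toℕ (inject₁ j)
    inject₁-preserves e = trans (Fin.toℕ-inject₁ i) (trans e (sym (Fin.toℕ-inject₁ j)))
    inject₁≢fromℕ : toℕ (inject₁ i) ≢ toℕ (fromℕ m)
    inject₁≢fromℕ e = Fin.toℕ-inject₁-≢ i (trans (sym (Fin.toℕ-fromℕ m)) (sym e))

upperOnes-suc : ∀ {n} (p k : Fin n) → upperOnes (suc n) (suc p) (suc k) ≡ upperOnes n p k
upperOnes-suc p k =
  cong (λ t → if t then 1ℤ else 0ℤ) (⌊⌋-⇔ (mk⇔ s≤s⁻¹ s≤s) (suc (toℕ p) ≤? suc (toℕ k)) (toℕ p ≤? toℕ k))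

upperOnes-suc-zero : ∀ {n} (p : Fin n) → upperOnes (suc n) (suc p) zero ≡ 0ℤ
upperOnes-suc-zero p = cong (λ t → if t then 1ℤ else 0ℤ) (⌊⌋-false (suc (toℕ p) ≤? 0) λ ())

∑-*-upperOnes : ∀ {n} (a : ℕ → ℤ) (k : Fin n) →
  ∑[ p < n ] (a (toℕ p) * upperOnes n p k) ≡ ∑[ p ≤ toℕ k ] a (toℕ p)
∑-*-upperOnes {suc n} a zero = cong₂ _+_ (ℤ.*-identityʳ (a 0))
  (∑-zero {n} λ p → trans (cong (a (suc (toℕ p)) *_) (upperOnes-suc-zero p)) (ℤ.*-zeroʳ (a (suc (toℕ p)))))
∑-*-upperOnes {suc n} a (suc k) = cong₂ _+_ (ℤ.*-identityʳ (a 0))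
  (trans (sum-cong-≗ {n} λ p → cong (a (suc (toℕ p)) *_) (upperOnes-suc p k)) (∑-*-upperOnes (a ∘ suc) k))

-- The Riordan array and the series u

riordanTrunc-·-upperOnes : (u v : Series) (n : ℕ) (l k : Fin n) →
  (riordanTrunc u v n · upperOnes n) l k ≡ ∑[ p ≤ toℕ k ] (u ⊛ powS v (toℕ p)) (toℕ l)
riordanTrunc-·-upperOnes u v n l k =
  trans (·-sum (riordanTrunc u v n) (upperOnes n) l k) (∑-*-upperOnes (λ p → (u ⊛ powS v p) (toℕ l)) k)

riordan-partialSum-head : (g f : Series) → g 0 ≡ 1ℤ → f 0 ≡ 0ℤ →
  ∀ K → ∑[ p ≤ K ] (g ⊛ powS f (toℕ p)) 0 ≡ 1ℤ
riordan-partialSum-head g f g₀≡1 f₀≡0 K = cong₂ _+_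
  (trans (⊛-head g oneS) (cong (_* 1ℤ) g₀≡1))
  (∑-zero {K} λ p → ⊛-orderʳ g (powS f (suc (toℕ p))) (powS-order f f₀≡0 (suc (toℕ p))) 0 (s≤s z≤n))

module _ (g f u : Series) (f₀≡0 : f 0 ≡ 0ℤ)
         (u-def : ∀ i → (u ⊛ (oneS ⊕ negS f)) i ≡ negS (g ⊛ divX f) i) where

  u⊛f≗u⊕g⊛divXf : u ⊛ f ≗ u ⊕ (g ⊛ divX f)
  u⊛f≗u⊕g⊛divXf t = x-y≡-z⇒y≡x+z (u t) ((u ⊛ f) t) ((g ⊛ divX f) t) (begin
    u t - (u ⊛ f) t                    ≡⟨ cong₂ _+_ (⊛-identityʳ u t) (⊛-negʳ u f t) ⟨
    (u ⊛ oneS) t + (u ⊛ negS f) t      ≡⟨ ⊛-distribˡ-⊕ u oneS (negS f) t ⟨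
    (u ⊛ (oneS ⊕ negS f)) t            ≡⟨ u-def t ⟩
    - (g ⊛ divX f) t                   ∎)
    where
    x-y≡-z⇒y≡x+z : ∀ x y z → x - y ≡ - z → y ≡ x + z
    x-y≡-z⇒y≡x+z x y z eq = begin
      y                  ≡⟨ lemma x y ⟩
      x - (x - y)        ≡⟨ cong (_-_ x) eq ⟩
      x - - z            ≡⟨ cong (_+_ x) (ℤ.neg-involutive z) ⟩
      x + z              ∎
      where
      lemma : ∀ x y → y ≡ x - (x - y)
      lemma = solve-∀

  u⊛powS-suc : ∀ k → u ⊛ powS f (suc k) ≗ (u ⊛ powS f k) ⊕ divX (g ⊛ powS f (suc k))
  u⊛powS-suc k i = begin
    (u ⊛ (f ⊛ fᵏ)) i                          ≡⟨ ⊛-assoc u f fᵏ i ⟨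
    ((u ⊛ f) ⊛ fᵏ) i                          ≡⟨ ⊛-congˡ fᵏ u⊛f≗u⊕g⊛divXf i ⟩
    ((u ⊕ (g ⊛ divX f)) ⊛ fᵏ) i               ≡⟨ ⊛-distribʳ-⊕ u (g ⊛ divX f) fᵏ i ⟩
    (u ⊛ fᵏ) i + ((g ⊛ divX f) ⊛ fᵏ) i        ≡⟨ cong (_+_ ((u ⊛ fᵏ) i)) tail-term ⟩
    (u ⊛ fᵏ) i + divX (g ⊛ (f ⊛ fᵏ)) i        ∎
    where
    fᵏ : Series
    fᵏ = powS f k
    tail-term : ((g ⊛ divX f) ⊛ fᵏ) i ≡ divX (g ⊛ (f ⊛ fᵏ)) i
    tail-term = begin
      ((g ⊛ divX f) ⊛ fᵏ) i      ≡⟨ ⊛-assoc g (divX f) fᵏ i ⟩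
      (g ⊛ (divX f ⊛ fᵏ)) i      ≡⟨ ⊛-congʳ g (divX-⊛ˡ f fᵏ f₀≡0) i ⟨
      (g ⊛ divX (f ⊛ fᵏ)) i      ≡⟨ divX-⊛ʳ g (f ⊛ fᵏ) (powS-order f f₀≡0 (suc k) 0 (s≤s z≤n)) i ⟨
      divX (g ⊛ (f ⊛ fᵏ)) i      ∎

  u⊛powS-as-partialSums : ∀ m i → i < m → ∀ k →
    (u ⊛ powS f k) i ≡ ∑[ p ≤ k ] (g ⊛ powS f (toℕ p)) (suc i) - ∑[ p ≤ m ] (g ⊛ powS f (toℕ p)) (suc i)
  u⊛powS-as-partialSums m i i<m =
    telescope-anchored (λ k → (u ⊛ powS f k) i) (λ p → (g ⊛ powS f p) (suc i))
      (λ k → u⊛powS-suc k i) m (⊛-orderʳ u (powS f m) (powS-order f f₀≡0 m) i i<m)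

mainTheorem12 : (g f : Series) → g 0 ≡ + 1 → f 0 ≡ + 0 → f 1 ≡ + 1 →
    (m : ℕ) → 1 ≤ m →
    (H : Mat (suc m)) →
    IsInverseOf H (riordanTrunc g f (suc m) · upperOnes (suc m)) →
    (u : Series) → (∀ i → (u ⊛ (oneS ⊕ negS f)) i ≡ negS (g ⊛ divX f) i) →
    IsInverseOf (riordanTrunc u f m) (subP H)
mainTheorem12 g f g₀≡1 f₀≡0 _ m _ H H⁻¹ u u-def =
  subP-inverse S H (riordanTrunc u f m) H⁻¹ row₀ entries
  where
  S : Mat (suc m)
  S = riordanTrunc g f (suc m) · upperOnes (suc m)
  P : ℕ → ℕ → ℤ
  P l K = ∑[ p ≤ K ] (g ⊛ powS f (toℕ p)) l
  S≡P : ∀ l k → S l k ≡ P (toℕ l) (toℕ k)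
  S≡P = riordanTrunc-·-upperOnes g f (suc m)
  row₀ : ∀ k → S zero k ≡ 1ℤ
  row₀ k = trans (S≡P zero k) (riordan-partialSum-head g f g₀≡1 f₀≡0 (toℕ k))
  entries : ∀ i k → riordanTrunc u f m i k ≡ S (suc i) (inject₁ k) - S (suc i) (fromℕ m)
  entries i k = begin
    (u ⊛ powS f (toℕ k)) (toℕ i)
      ≡⟨ u⊛powS-as-partialSums g f u f₀≡0 u-def m (toℕ i) (Fin.toℕ<n i) (toℕ k) ⟩
    P (suc (toℕ i)) (toℕ k) - P (suc (toℕ i)) m
      ≡⟨ cong₂ (λ k' m' → P (suc (toℕ i)) k' - P (suc (toℕ i)) m') (Fin.toℕ-inject₁ k) (Fin.toℕ-fromℕ m) ⟨
    P (suc (toℕ i)) (toℕ (inject₁ k)) - P (suc (toℕ i)) (toℕ (fromℕ m))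
      ≡⟨ cong₂ _-_ (S≡P (suc i) (inject₁ k)) (S≡P (suc i) (fromℕ m)) ⟨
    S (suc i) (inject₁ k) - S (suc i) (fromℕ m)
      ∎
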